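{- For every ecumenical formula of the form $A^c$ (with $A^i$ its intuitionistic counterpart), both $A^c\Vdash\neg\neg A^i$ and $\neg\neg A^i\Vdash A^c$ hold.
   Context: Basic setting. Let $\mathsf{At}$ be a countably infinite set of atomic propositions and $\mathsf{At}_\bot=\mathsf{At}\cup\{\bot\}$. An atomic rule has the form "from premises $p_1,\dots,p_n$ ($n\ge 0$) infer $p$", with $p_j,p\in\mathsf{At}_\bot$, where the derivation of each premise may discharge a set of basic sentences. An atomic system $S$ is a set of atomic rules; $S\subseteq S'$ ($S'$ extends $S$) if $S'$ contains all rules of $S$. $\Delta\vdash_S p$ means there is a natural-deduction derivation using only rules of $S$ with conclusion $p$ and undischarged assumptions in $\Delta$ (so $p\vdash_S p$). $S$ is consistent if $\nvdash_S\bot$. Standing convention: all atomic systems (including all extensions quantified over) are required to be consistent. Ecumenical formulas: $p^i,p^c$ for $p\in\mathsf{At}_\bot$; $(A\wedge B)^x,(A\vee B)^x,(A\to B)^x$ for $x\in\{i,c\}$. $A\wedge B$, $A\vee B$, $A\to B$ abbreviate the $i$-versions, $\bot$ denotes $\bot^i$, $\neg A:=(A\to\bot^i)^i$; for a formula $X^c$ (atomic or not), $X^i$ is the same construction with outer superscript $i$. Weak validity (by simultaneous recursion): (1) $\Vdash^L_S p^i$ iff $\vdash_S p$ ($p\in\mathsf{At}_\bot$); (2) $\Vdash^L_S p^c$ iff $p\nvdash_S\bot$; (3) for non-atomic $X$, $\Vdash^L_S X^c$ iff $X^i\nVdash^L_S\bot$; (4) $\Vdash^L_S(A\wedge B)^i$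 iff $\Vdash^L_S A$ and $\Vdash^L_S B$; (5) $\Vdash^L_S(A\to B)^i$ iff $A\Vdash^G_S B$; (6) $\Vdash^L_S(A\vee B)^i$ iff for all $S'\supseteq S$ and all $p\in\mathsf{At}_\bot$, if $A\Vdash^L_{S'}p^i$ and $B\Vdash^L_{S'}p^i$ then $\Vdash^L_{S'}p^i$; (7) for nonempty $\Gamma$, $\Gamma\Vdash^L_S A$ iff for all $S'\supseteq S$, if $\Vdash^L_{S'}B$ for all $B\in\Gamma$ then $\Vdash^L_{S'}A$; (8) $\Gamma\Vdash^G_S A$ iff for all $S'\supseteq S$: if $\Vdash^L_{S''}B$ for all $B\in\Gamma$ and all $S''\supseteq S'$, then $\Vdash^L_{S''}A$ for all $S''\supseteq S'$; (9) $\Gamma\Vdash A$ iff $\Gamma\Vdash^G_S A$ for all atomic systems $S$. -}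

module Defs where

open import Level using (Lift; lift) renaming (suc to lsuc; zero to lzero)
open import Data.Nat using (ℕ)
open import Data.List using (List; []; _∷_; _++_)
open import Data.List.Membership.Propositional using (_∈_)
open import Data.List.Relation.Unary.All using (All)
open import Data.Product using (_×_; proj₁; proj₂)
open import Relation.Nullary using (¬_)

data At⊥ : Set where
  atm : ℕ → At⊥
  bot : At⊥

-- Atomic rules: premises p₁ … pₙ, each with the list of basic
-- sentences its derivation may discharge; conclusion p.

record Rule : Set where
  constructor rule
  field
    premises   : List (List At⊥ × At⊥)
    conclusion : At⊥
open Rule public

System : Set₁
System = Rule → Set

_⊑_ : System → System → Set
S ⊑ S' = ∀ r → S r → S' r

data _⊢[_]_ (Δ : List At⊥) (S : System) : At⊥ → Set where
  assume : ∀ {p} → p ∈ Δ → Δ ⊢[ S ] p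
  apply  : (r : Rule) → S r →
           All (λ prem → (proj₁ prem ++ Δ) ⊢[ S ] proj₂ prem) (premises r) →
           Δ ⊢[ S ] conclusion r

Consistent : System → Set
Consistent S = ¬ ([] ⊢[ S ] bot)

-- consistent extension (standing convention: all systems consistent)
Ext : System → System → Set
Ext S S' = S ⊑ S' × Consistent S'

data Tag : Set where
  i c : Tag

data Shape : Set
data Form : Set

data Shape where
  atom : At⊥ → Shape
  conj : Form → Form → Shape
  disj : Form → Form → Shape
  impl : Form → Form → Shape

data Form where
  _^_ : Shape → Tag → Form

⊥ⁱ : Form
⊥ⁱ = atom bot ^ i

¬ⁱ : Form → Form
¬ⁱ A = impl A ⊥ⁱ ^ i

-- Weak validity ⊩ᴸ_S A (empty context), clauses (1)–(6); the
-- context-clauses (7),(8) for singleton contexts are unfolded inline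
-- where needed (and given as definitions below).

mutual
  V : System → Form → Set₁
  V S (s ^ i) = Vi S s
  V S (atom p ^ c) = Lift (lsuc lzero) (¬ ((p ∷ []) ⊢[ S ] bot))
  -- (3): X^c valid iff X^i ⊮ᴸ_S ⊥ (clause (7) with Γ = [X^i], clause (1) for ⊥)
  V S (conj A B ^ c) = ¬ (∀ S' → Ext S S' → Vi S' (conj A B) → Lift (lsuc lzero) ([] ⊢[ S' ] bot))
  V S (disj A B ^ c) = ¬ (∀ S' → Ext S S' → Vi S' (disj A B) → Lift (lsuc lzero) ([] ⊢[ S' ] bot))
  V S (impl A B ^ c) = ¬ (∀ S' → Ext S S' → Vi S' (impl A B) → Lift (lsuc lzero) ([] ⊢[ S' ] bot))

  Vi : System → Shape → Set₁
  Vi S (atom p) = Lift (lsuc lzero) ([] ⊢[ S ] p)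
  Vi S (conj A B) = V S A × V S B
  -- (5): A ⊩ᴳ_S B  (clause (8) with Γ = [A])
  Vi S (impl A B) = ∀ S' → Ext S S' →
                     (∀ S'' → Ext S' S'' → V S'' A) →
                     (∀ S'' → Ext S' S'' → V S'' B)
  -- (6): A ⊩ᴸ_{S'} p^i is clause (7) with Γ = [A], clause (1) for p^i
  Vi S (disj A B) = ∀ S' → Ext S S' → ∀ (p : At⊥) →
                     (∀ S'' → Ext S' S'' → V S'' A → Lift (lsuc lzero) ([] ⊢[ S'' ] p)) →
                     (∀ S'' → Ext S' S'' → V S'' B → Lift (lsuc lzero) ([] ⊢[ S'' ] p)) →
                     Lift (lsuc lzero) ([] ⊢[ S' ] p)

_⊩G[_]_ : List Form → System → Form → Set₁
Γ ⊩G[ S ] A = ∀ S' → Ext S S' →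
                (∀ S'' → Ext S' S'' → All (V S'') Γ) →
                (∀ S'' → Ext S' S'' → V S'' A)

_⊩_ : List Form → Form → Set₁
Γ ⊩ A = ∀ (S : System) → Consistent S → Γ ⊩G[ S ] A

-- By the clause for implication, ¬ⁱ F holds at S exactly when F is refuted at
-- S, i.e. no extension of S stably forces F. So ¬ⁱ ¬ⁱ X^i holds stably at S
-- iff X^i is refuted at no extension of S, and it remains to show that this is
-- also what "X^c holds stably at S" means. One direction is immediate from
-- clauses (2) and (3). For the other, if p ⊬ ⊥ then adding p as an axiom gives
-- a consistent extension that stably forces p^i; for compound X, clause (3)
-- makes X^i densely forced, and a formula that is forced and densely forced
-- at S is forced at every extension of S. The detour through density is
-- needed because classical atoms are not persistent.
module Submission where

open import Defs
open import Data.Empty using (⊥-elim)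
open import Data.List using (List; []; _∷_; _++_)
open import Data.List.Membership.Propositional using (_∈_)
open import Data.List.Membership.Propositional.Properties using (∈-++⁺ˡ; ∈-++⁺ʳ; ∈-++⁻)
open import Data.List.Relation.Binary.Subset.Propositional using (_⊆_)
open import Data.List.Relation.Binary.Subset.Propositional.Properties using (⊆-refl; ++⁺ʳ)
open import Data.List.Relation.Unary.All using (All; []; _∷_)
open import Data.List.Relation.Unary.Any using (here)
open import Data.Product using (_×_; _,_; proj₁; proj₂)
open import Data.Sum using (_⊎_; inj₁; inj₂)
open import Level using (Lift; lift; lower) renaming (suc to lsuc; zero to lzero)
open import Relation.Binary.PropositionalEquality using (_≡_; refl)
open import Relation.Nullary using (¬_)

⊑-refl : ∀ {S} → S ⊑ S
⊑-refl _ r∈S = r∈S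

Ext-refl : ∀ {S} → Consistent S → Ext S S
Ext-refl cS = ⊑-refl , cS

Ext-trans : ∀ {S T U} → Ext S T → Ext T U → Ext S U
Ext-trans (S⊑T , _) (T⊑U , cU) = (λ r r∈S → T⊑U r (S⊑T r r∈S)) , cU

Premises : System → List At⊥ → List (List At⊥ × At⊥) → Set
Premises S Δ = All (λ prem → (proj₁ prem ++ Δ) ⊢[ S ] proj₂ prem)

mutual
  ⊢-weaken : ∀ {S S' Δ Γ q} → S ⊑ S' → Δ ⊆ Γ → Δ ⊢[ S ] q → Γ ⊢[ S' ] q
  ⊢-weaken S⊑S' Δ⊆Γ (assume q∈Δ) = assume (Δ⊆Γ q∈Δ)
  ⊢-weaken S⊑S' Δ⊆Γ (apply r r∈S ds) = apply r (S⊑S' r r∈S) (premises-weaken S⊑S' Δ⊆Γ ds)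

  premises-weaken : ∀ {S S' Δ Γ} → S ⊑ S' → Δ ⊆ Γ → ∀ {ps} → Premises S Δ ps → Premises S' Γ ps
  premises-weaken S⊑S' Δ⊆Γ [] = []
  premises-weaken S⊑S' Δ⊆Γ {(xs , _) ∷ _} (d ∷ ds) =
    ⊢-weaken S⊑S' (++⁺ʳ xs Δ⊆Γ) d ∷ premises-weaken S⊑S' Δ⊆Γ ds

Subst : System → List At⊥ → List At⊥ → Set
Subst S Δ Γ = ∀ {x} → x ∈ Δ → Γ ⊢[ S ] x

Subst-++ : ∀ {S Δ Γ} xs → Subst S Δ Γ → Subst S (xs ++ Δ) (xs ++ Γ)
Subst-++ xs σ x∈ with ∈-++⁻ xs x∈
... | inj₁ x∈xs = assume (∈-++⁺ˡ x∈xs)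
... | inj₂ x∈Δ = ⊢-weaken ⊑-refl (∈-++⁺ʳ xs) (σ x∈Δ)

mutual
  ⊢-subst : ∀ {S Δ Γ q} → Subst S Δ Γ → Δ ⊢[ S ] q → Γ ⊢[ S ] q
  ⊢-subst σ (assume q∈Δ) = σ q∈Δ
  ⊢-subst σ (apply r r∈S ds) = apply r r∈S (premises-subst σ ds)

  premises-subst : ∀ {S Δ Γ} → Subst S Δ Γ → ∀ {ps} → Premises S Δ ps → Premises S Γ ps
  premises-subst σ [] = []
  premises-subst σ {(xs , _) ∷ _} (d ∷ ds) = ⊢-subst (Subst-++ xs σ) d ∷ premises-subst σ ds

withAxiom : System → At⊥ → System
withAxiom S p r = S r ⊎ (r ≡ rule [] p)

mutual
  ⊢-eliminate-axiom : ∀ {S p Δ Γ q} → Subst S Δ Γ → Γ ⊢[ S ] p →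
                      Δ ⊢[ withAxiom S p ] q → Γ ⊢[ S ] q
  ⊢-eliminate-axiom σ ⊢p (assume q∈Δ) = σ q∈Δ
  ⊢-eliminate-axiom σ ⊢p (apply r (inj₁ r∈S) ds) = apply r r∈S (premises-eliminate-axiom σ ⊢p ds)
  ⊢-eliminate-axiom σ ⊢p (apply _ (inj₂ refl) []) = ⊢p

  premises-eliminate-axiom : ∀ {S p Δ Γ} → Subst S Δ Γ → Γ ⊢[ S ] p →
                             ∀ {ps} → Premises (withAxiom S p) Δ ps → Premises S Γ ps
  premises-eliminate-axiom σ ⊢p [] = []
  premises-eliminate-axiom σ ⊢p {(xs , _) ∷ _} (d ∷ ds) =
    ⊢-eliminate-axiom (Subst-++ xs σ) (⊢-weaken ⊑-refl (∈-++⁺ʳ xs) ⊢p) d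
      ∷ premises-eliminate-axiom σ ⊢p ds

Ext-withAxiom : ∀ {S p} → ¬ ((p ∷ []) ⊢[ S ] bot) → Ext S (withAxiom S p)
Ext-withAxiom p⊬⊥ = (λ _ → inj₁) , λ ⊢⊥ → p⊬⊥ (⊢-eliminate-axiom (λ ()) (assume (here refl)) ⊢⊥)

Stable : System → Form → Set₁
Stable S F = ∀ S' → Ext S S' → V S' F

Stable-mono : ∀ {F S T} → Stable S F → Ext S T → Stable T F
Stable-mono ⊩F S⊑T U T⊑U = ⊩F U (Ext-trans S⊑T T⊑U)

Stable-withAxiom : ∀ S p → Stable (withAxiom S p) (atom p ^ i)
Stable-withAxiom S p T (S⊑T , _) = lift (apply (rule [] p) (S⊑T _ (inj₂ refl)) [])

Refuted : System → Form → Set₁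
Refuted S F = ∀ S' → Ext S S' → ¬ Stable S' F

Refuted-mono : ∀ {F S T} → Refuted S F → Ext S T → Refuted T F
Refuted-mono r S⊑T U T⊑U = r U (Ext-trans S⊑T T⊑U)

¬ⁱ-intro : ∀ {F S} → Refuted S F → V S (¬ⁱ F)
¬ⁱ-intro r T S⊑T ⊩F = ⊥-elim (r T S⊑T ⊩F)

¬ⁱ-elim : ∀ {F S} → V S (¬ⁱ F) → Refuted S F
¬ⁱ-elim ⊩¬F T S⊑T@(_ , cT) ⊩F = cT (lower (⊩¬F T S⊑T ⊩F T (Ext-refl cT)))

Dense : System → Form → Set₁
Dense S F = ∀ S' → Ext S S' → ¬ (∀ S'' → Ext S' S'' → ¬ V S'' F)

Dense-map : ∀ {F G S} → (∀ {U} → V U F → V U G) → Dense S F → Dense S G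
Dense-map f dense T S⊑T ¬G = dense T S⊑T (λ U T⊑U ⊩F → ¬G U T⊑U (f ⊩F))

-- X^c for non-atomic X: clause (3), X^i ⊮ ⊥.
Compatible : System → Shape → Set₁
Compatible S X = ¬ (∀ S' → Ext S S' → Vi S' X → Lift (lsuc lzero) ([] ⊢[ S' ] bot))

Compatible-if-dense : ∀ {S U X} → Ext S U →
  (∀ S' → Ext S S' → ¬ (∀ S'' → Ext S' S'' → ¬ Compatible S'' X)) → Compatible U X
Compatible-if-dense S⊑U dense ⊩⊥ =
  dense _ S⊑U (λ U' U⊑U' compat → compat (λ T U'⊑T → ⊩⊥ T (Ext-trans U⊑U' U'⊑T)))

Stable-if-dense : ∀ F {S} → V S F → Dense S F → Stable S F
Stable-if-dense (atom p ^ i) (lift ⊢p) dense U (S⊑U , _) = lift (⊢-weaken S⊑U ⊆-refl ⊢p)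
Stable-if-dense (conj A B ^ i) (⊩A , ⊩B) dense U S⊑U =
  Stable-if-dense A ⊩A (Dense-map {conj A B ^ i} {A} proj₁ dense) U S⊑U ,
  Stable-if-dense B ⊩B (Dense-map {conj A B ^ i} {B} proj₂ dense) U S⊑U
Stable-if-dense (disj A B ^ i) ⊩A∨B dense U S⊑U T U⊑T = ⊩A∨B T (Ext-trans S⊑U U⊑T)
Stable-if-dense (impl A B ^ i) ⊩A→B dense U S⊑U T U⊑T = ⊩A→B T (Ext-trans S⊑U U⊑T)
Stable-if-dense (atom p ^ c) _ dense U S⊑U =
  lift (λ p⊢⊥ → dense U S⊑U (λ U' (U⊑U' , _) ⊩pᶜ → lower ⊩pᶜ (⊢-weaken U⊑U' ⊆-refl p⊢⊥)))
Stable-if-dense (conj A B ^ c) _ dense U S⊑U = Compatible-if-dense {X = conj A B} S⊑U dense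
Stable-if-dense (disj A B ^ c) _ dense U S⊑U = Compatible-if-dense {X = disj A B} S⊑U dense
Stable-if-dense (impl A B ^ c) _ dense U S⊑U = Compatible-if-dense {X = impl A B} S⊑U dense

Stably-compatible⇒¬Refuted : ∀ X {S} → Consistent S →
  (∀ S' → Ext S S' → Compatible S' X) → ¬ Refuted S (X ^ i)
Stably-compatible⇒¬Refuted X {S} cS compat r =
  compat S (Ext-refl cS) λ S' S⊑S' ⊩X →
    ⊥-elim (r S' S⊑S' (Stable-if-dense (X ^ i) ⊩X (dense S⊑S')))
  where
  dense : ∀ {S'} → Ext S S' → Dense S' (X ^ i)
  dense S⊑S' U S'⊑U ¬X = compat U (Ext-trans S⊑S' S'⊑U) (λ U' U⊑U' ⊩X → ⊥-elim (¬X U' U⊑U' ⊩X))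

Stable-classical⇒¬Refuted : ∀ X {S} → Consistent S → Stable S (X ^ c) → ¬ Refuted S (X ^ i)
Stable-classical⇒¬Refuted (atom p) {S} cS ⊩pᶜ r =
  r (withAxiom S p) (Ext-withAxiom (lower (⊩pᶜ S (Ext-refl cS)))) (Stable-withAxiom S p)
Stable-classical⇒¬Refuted (conj A B) = Stably-compatible⇒¬Refuted (conj A B)
Stable-classical⇒¬Refuted (disj A B) = Stably-compatible⇒¬Refuted (disj A B)
Stable-classical⇒¬Refuted (impl A B) = Stably-compatible⇒¬Refuted (impl A B)

¬Refuted⇒Compatible : ∀ X {S} → ¬ Refuted S (X ^ i) → Compatible S X
¬Refuted⇒Compatible X nr ⊩⊥ =
  nr λ T S⊑T@(_ , cT) ⊩X → cT (lower (⊩⊥ T S⊑T (⊩X T (Ext-refl cT))))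

¬Refuted⇒classical : ∀ X {S} → ¬ Refuted S (X ^ i) → V S (X ^ c)
¬Refuted⇒classical (atom p) nr = lift (λ p⊢⊥ → nr (λ T (S⊑T , cT) ⊩p →
  cT (⊢-subst (λ { (here refl) → lower (⊩p T (Ext-refl cT)) }) (⊢-weaken S⊑T ⊆-refl p⊢⊥))))
¬Refuted⇒classical (conj A B) = ¬Refuted⇒Compatible (conj A B)
¬Refuted⇒classical (disj A B) = ¬Refuted⇒Compatible (disj A B)
¬Refuted⇒classical (impl A B) = ¬Refuted⇒Compatible (impl A B)

Stable-classical⇒Stable-¬¬ : ∀ X {S} → Stable S (X ^ c) → Stable S (¬ⁱ (¬ⁱ (X ^ i)))
Stable-classical⇒Stable-¬¬ X ⊩Xᶜ S' S⊑S' = ¬ⁱ-intro {¬ⁱ (X ^ i)} λ T S'⊑T@(_ , cT) ⊩¬X →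
  Stable-classical⇒¬Refuted X cT (Stable-mono {X ^ c} ⊩Xᶜ (Ext-trans S⊑S' S'⊑T))
    (¬ⁱ-elim {X ^ i} (⊩¬X T (Ext-refl cT)))

Stable-¬¬⇒Stable-classical : ∀ X {S} → Stable S (¬ⁱ (¬ⁱ (X ^ i))) → Stable S (X ^ c)
Stable-¬¬⇒Stable-classical X ⊩¬¬X S' S⊑S'@(_ , cS') = ¬Refuted⇒classical X λ r →
  ¬ⁱ-elim {¬ⁱ (X ^ i)} (⊩¬¬X S' S⊑S') S' (Ext-refl cS')
    (λ T S'⊑T → ¬ⁱ-intro {X ^ i} (Refuted-mono r S'⊑T))

⊩-intro : ∀ {A B} → (∀ {S} → Stable S A → Stable S B) → (A ∷ []) ⊩ B
⊩-intro A⇒B _ _ _ _ ⊩A = A⇒B λ S'' S'⊑S'' → head (⊩A S'' S'⊑S'')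
  where
  head : ∀ {U A} → All (V U) (A ∷ []) → V U A
  head (⊩A ∷ []) = ⊩A

theorem5 : ∀ (X : Shape) →
    (((X ^ c) ∷ []) ⊩ ¬ⁱ (¬ⁱ (X ^ i))) × (((¬ⁱ (¬ⁱ (X ^ i))) ∷ []) ⊩ (X ^ c))
theorem5 X =
  ⊩-intro {X ^ c} {¬ⁱ (¬ⁱ (X ^ i))} (Stable-classical⇒Stable-¬¬ X) ,
  ⊩-intro {¬ⁱ (¬ⁱ (X ^ i))} {X ^ c} (Stable-¬¬⇒Stable-classical X)
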